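{- In a reduced graph $G$ with $n$ vertices and maximum degree $\Delta$, every feedback vertex set has size at least $\frac{n}{5\Delta}$.
   Context: All graphs are finite, simple and loopless. $N(x)$ is the neighbourhood and $d(x)=|N(x)|$ the degree of $x$. A feedback vertex set of $G=(V,E)$ is a set $S\subseteq V$ such that the subgraph induced by $V\setminus S$ is a forest. A graph $G$ is called reduced if it has no vertex of degree at most $1$, and there is no edge $uv$ with $d(u)=d(v)=2$ and $N(u)\cap N(v)=\emptyset$. -}

module Defs where

open import Data.Nat using (ℕ; _≤_; _⊔_)
open import Data.Fin using (Fin)
open import Data.Fin.Subset using (Subset; ∣_∣; _∩_; _∈_; _∉_; Empty)
open import Data.Bool using (Bool; true; false)
open import Data.Vec using (tabulate)
open import Data.List using (List; []; _∷_; _∷ʳ_; length; map; foldr; allFin)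
open import Data.List.Relation.Unary.All using (All)
open import Data.List.Relation.Unary.Unique.Propositional using (Unique)
open import Data.List.Relation.Unary.Linked using (Linked)
open import Data.Product using (_×_; Σ)
open import Data.Empty using (⊥)
open import Relation.Binary.PropositionalEquality using (_≡_)
open import Relation.Nullary using (¬_)

record Graph (n : ℕ) : Set where
  field
    adj   : Fin n → Fin n → Bool
    sym   : ∀ x y → adj x y ≡ adj y x
    irrefl : ∀ x → adj x x ≡ false

open Graph public

Adj : ∀ {n} → Graph n → Fin n → Fin n → Set
Adj G x y = adj G x y ≡ true

N : ∀ {n} → Graph n → Fin n → Subset n
N G x = tabulate (adj G x)

deg : ∀ {n} → Graph n → Fin n → ℕ
deg G x = ∣ N G x ∣

-- maximum degree Δ (0 for the empty graph)
maxDeg : ∀ {n} → Graph n → ℕ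
maxDeg {n} G = foldr _⊔_ 0 (map (deg G) (allFin n))

Reduced : ∀ {n} → Graph n → Set
Reduced G =
  (∀ x → 2 ≤ deg G x) ×
  (∀ u v → Adj G u v → ¬ (deg G u ≡ 2 × deg G v ≡ 2 × Empty (N G u ∩ N G v)))

IsCycle : ∀ {n} → Graph n → List (Fin n) → Set
IsCycle G [] = ⊥
IsCycle G (v ∷ ws) = (2 ≤ length ws) × Unique (v ∷ ws) × Linked (Adj G) ((v ∷ ws) ∷ʳ v)

FVS : ∀ {n} → Graph n → Subset n → Set
FVS G S = ∀ cs → IsCycle G cs → All (_∉ S) cs → ⊥

-- Let F = V ∖ S; it induces a forest, so the F-degrees of its vertices sum to less than 2|F|.
-- Split F into Z, the vertices of degree 2 without neighbours in S, and W = F ∖ Z. Since G is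
-- reduced and F is acyclic, Z is independent (two adjacent Z-vertices with a common neighbour
-- would span a triangle in F), so each Z-vertex has both neighbours in W; and every W-vertex v
-- has 2 d_S(v) + d_F(v) ≥ 3. Give each vertex of F charge 12 and let each W-vertex pass one unit
-- to each Z-neighbour: locally 12 + d_Z ≤ 8 d_S + 5 d_F on W and 12 ≤ 5 d_F + d_W on Z, which
-- sum to 12|F| ≤ 8 e(F,S) + 10|F|. Hence |F| ≤ 4 e(F,S) ≤ 4Δ|S| and n = |S| + |F| ≤ 5Δ|S|.

module Submission where

open import Defs hiding (sym)
open import Data.Nat using (ℕ; NonZero; >-nonZero; zero; suc; _+_; _*_; _≤_; _<_; _⊔_; _≤?_; z≤n; s≤s; _≡ᵇ_)
open import Data.Nat.Properties hiding (_≟_)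
open import Data.Nat.Tactic.RingSolver using (solve-∀)
open import Data.Fin using (Fin; zero; suc; _≟_)
open import Data.Fin.Properties using (any?; pigeonhole)
open import Data.Fin.Subset using (Subset; ∣_∣; _∩_; _∈_; _∉_; Empty)
open import Data.Fin.Subset.Properties using (x∈p∩q⁻)
open import Data.Bool using (Bool; true; false; T; T?; not; _∧_) renaming (_≟_ to _≟ᵇ_)
open import Data.Bool.Properties using (T-≡; T-∧; ∧-identityʳ)
open import Data.Vec using (tabulate; lookup)
open import Data.Vec.Properties using ([]=⇒lookup; lookup∘tabulate; tabulate∘lookup)
open import Data.List using (List; []; _∷_; _∷ʳ_; length; map; foldr; allFin)
import Data.List as List
open import Data.List.Membership.Propositional using () renaming (_∈_ to _∈ₗ_)
open import Data.List.Membership.Propositional.Properties using (∈-map⁺; ∈-allFin; ∈-lookup)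
open import Data.List.Relation.Unary.All as All using (All; []; _∷_)
open import Data.List.Relation.Unary.All.Properties using (¬Any⇒All¬)
open import Data.List.Relation.Unary.AllPairs using (AllPairs; []; _∷_)
open import Data.List.Relation.Unary.Any using (here; there)
open import Data.List.Relation.Unary.Linked using (Linked; [-]; _∷_)
open import Data.List.Relation.Unary.Unique.Propositional using (Unique)
open import Data.Product using (_×_; ∃; _,_; proj₁; proj₂)
open import Data.Empty using (⊥; ⊥-elim)
open import Relation.Nullary using (¬_; yes; no; does; contradiction; ¬?; _×-dec_)
open import Function using (_∘_; Equivalence)
open import Relation.Binary.PropositionalEquality
open import Algebra.Properties.Semiring.Sum +-*-semiring
  using (sum; sum-cong-≗; ∑-distrib-+; ∑-comm; *-distribˡ-sum; *-distribʳ-sum)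

𝟙 : Bool → ℕ
𝟙 true = 1
𝟙 false = 0

𝟙≤1 : ∀ b → 𝟙 b ≤ 1
𝟙≤1 true = ≤-refl
𝟙≤1 false = z≤n

𝟙-+-not : ∀ b → 1 ≡ 𝟙 b + 𝟙 (not b)
𝟙-+-not true = refl
𝟙-+-not false = refl

𝟙-split-∧ : ∀ b c → 𝟙 b ≡ 𝟙 (b ∧ c) + 𝟙 (b ∧ not c)
𝟙-split-∧ false c = refl
𝟙-split-∧ true c = 𝟙-+-not c

T-not⇒¬T : ∀ {b} → T (not b) → ¬ T b
T-not⇒¬T {false} _ ()

𝟙*-mono : ∀ b {x y} → (T b → x ≤ y) → 𝟙 b * x ≤ 𝟙 b * y
𝟙*-mono true x≤y = +-monoˡ-≤ 0 (x≤y _)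
𝟙*-mono false _ = z≤n

δ : ∀ {n} → Fin n → Fin n → ℕ
δ x u = 𝟙 (does (x ≟ u))

sum-const : ∀ n c → sum {n} (λ _ → c) ≡ n * c
sum-const zero c = refl
sum-const (suc n) c = cong (c +_) (sum-const n c)

sum-zero : ∀ {n} {f : Fin n → ℕ} → (∀ i → f i ≡ 0) → sum f ≡ 0
sum-zero {n} f≡0 = trans (sum-cong-≗ f≡0) (trans (sum-const n 0) (*-zeroʳ n))

sum-mono-≤ : ∀ {n} {f g : Fin n → ℕ} → (∀ i → f i ≤ g i) → sum f ≤ sum g
sum-mono-≤ {zero} f≤g = z≤n
sum-mono-≤ {suc n} f≤g = +-mono-≤ (f≤g zero) (sum-mono-≤ (λ i → f≤g (suc i)))

term≤sum : ∀ {n} (f : Fin n → ℕ) x → f x ≤ sum f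
term≤sum f zero = m≤m+n (f zero) _
term≤sum f (suc x) = ≤-trans (term≤sum (λ i → f (suc i)) x) (m≤n+m _ (f zero))

sum-*-δ : ∀ {n} (g : Fin n → ℕ) x → sum (λ u → g u * δ x u) ≡ g x
sum-*-δ {suc n} g zero =
  trans (cong₂ _+_ (*-identityʳ (g zero)) (sum-zero (λ u → *-zeroʳ (g (suc u))))) (+-identityʳ (g zero))
sum-*-δ {suc n} g (suc x) =
  trans (cong (_+ sum (λ u → g (suc u) * δ x u)) (*-zeroʳ (g zero))) (sum-*-δ (λ u → g (suc u)) x)

sum-δ : ∀ {n} (x : Fin n) → sum (δ x) ≡ 1
sum-δ x = trans (sum-cong-≗ (λ u → sym (*-identityˡ (δ x u)))) (sum-*-δ (λ _ → 1) x)

∣tabulate∣ : ∀ {n} (b : Fin n → Bool) → ∣ tabulate b ∣ ≡ sum (λ i → 𝟙 (b i))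
∣tabulate∣ {zero} b = refl
∣tabulate∣ {suc n} b with b zero
... | true = cong suc (∣tabulate∣ (λ i → b (suc i)))
... | false = ∣tabulate∣ (λ i → b (suc i))

≤-foldr-⊔ : ∀ {x} (xs : List ℕ) → x ∈ₗ xs → x ≤ foldr _⊔_ 0 xs
≤-foldr-⊔ (y ∷ ys) (here refl) = m≤m⊔n y _
≤-foldr-⊔ (y ∷ ys) (there p) = ≤-trans (≤-foldr-⊔ ys p) (m≤n⊔m y _)

module _ {A : Set} where

  takeThrough : ∀ {u : A} {xs} → u ∈ₗ xs → List A
  takeThrough {xs = x ∷ _} (here _) = x ∷ []
  takeThrough {xs = x ∷ _} (there p) = x ∷ takeThrough p

  All-takeThrough : ∀ {P : A → Set} {u xs} (p : u ∈ₗ xs) → All P xs → All P (takeThrough p)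
  All-takeThrough (here _) (px ∷ _) = px ∷ []
  All-takeThrough (there p) (px ∷ pxs) = px ∷ All-takeThrough p pxs

  AllPairs-takeThrough : ∀ {R : A → A → Set} {u xs} (p : u ∈ₗ xs) → AllPairs R xs → AllPairs R (takeThrough p)
  AllPairs-takeThrough (here _) (_ ∷ _) = [] ∷ []
  AllPairs-takeThrough (there p) (rs ∷ rss) = All-takeThrough p rs ∷ AllPairs-takeThrough p rss

  takeThrough-nonEmpty : ∀ {u xs} (p : u ∈ₗ xs) → 1 ≤ length (takeThrough p)
  takeThrough-nonEmpty (here _) = s≤s z≤n
  takeThrough-nonEmpty (there _) = s≤s z≤n

  Linked-takeThrough : ∀ {R : A → A → Set} {u w xs} (p : u ∈ₗ xs) → Linked R xs → R u w →
                       Linked R (takeThrough p ∷ʳ w)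
  Linked-takeThrough (here refl) _ r = r ∷ [-]
  Linked-takeThrough (there (here refl)) (r′ ∷ rs) r = r′ ∷ Linked-takeThrough (here refl) rs r
  Linked-takeThrough (there (there p)) (r′ ∷ rs) r = r′ ∷ Linked-takeThrough (there p) rs r

  AllPairs-lookup : ∀ {R : A → A → Set} {xs} → AllPairs R xs →
                    ∀ {i j} → i Data.Fin.< j → R (List.lookup xs i) (List.lookup xs j)
  AllPairs-lookup (rs ∷ _) {zero} {suc j} _ = All.lookup rs (∈-lookup j)
  AllPairs-lookup (_ ∷ rss) {suc i} {suc j} (s≤s i<j) = AllPairs-lookup rss i<j

Unique⇒length≤ : ∀ {n} {xs : List (Fin n)} → Unique xs → length xs ≤ n
Unique⇒length≤ {n} {xs} uniq with length xs ≤? n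
... | yes ≤n = ≤n
... | no ≰n with pigeonhole (≰⇒> ≰n) (List.lookup xs)
...   | i , j , i<j , eq = contradiction eq (AllPairs-lookup uniq i<j)

module Adjacency {n} (G : Graph n) where

  Adj-sym : ∀ {v u} → Adj G v u → Adj G u v
  Adj-sym {v} {u} a = trans (Graph.sym G u v) a

  Adj⇒≢ : ∀ {v u} → Adj G v u → v ≢ u
  Adj⇒≢ {v} a refl with trans (sym a) (irrefl G v)
  ... | ()

  triangle : ∀ {v u x} → Adj G v u → Adj G u x → Adj G x v → IsCycle G (v ∷ u ∷ x ∷ [])
  triangle vu ux xv =
    s≤s (s≤s z≤n) ,
    (Adj⇒≢ vu ∷ Adj⇒≢ (Adj-sym xv) ∷ []) ∷ (Adj⇒≢ ux ∷ []) ∷ [] ∷ [] ,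
    vu ∷ ux ∷ xv ∷ [-]

  ∈N⇒Adj : ∀ {v x} → x ∈ N G v → Adj G v x
  ∈N⇒Adj {v} {x} x∈N = trans (sym (lookup∘tabulate (adj G v) x)) ([]=⇒lookup x∈N)

  degIn : (Fin n → ℕ) → Fin n → ℕ
  degIn h v = sum (λ u → 𝟙 (adj G v u) * h u)

  ⟪_,_⟫ : (Fin n → ℕ) → (Fin n → ℕ) → ℕ
  ⟪ g , h ⟫ = sum (λ v → g v * degIn h v)

  deg≡degIn-1 : ∀ v → deg G v ≡ degIn (λ _ → 1) v
  deg≡degIn-1 v = trans (∣tabulate∣ (adj G v)) (sum-cong-≗ (λ u → sym (*-identityʳ (𝟙 (adj G v u)))))

  deg≤maxDeg : ∀ v → deg G v ≤ maxDeg G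
  deg≤maxDeg v = ≤-foldr-⊔ (map (deg G) (allFin n)) (∈-map⁺ (deg G) (∈-allFin v))

  degIn-cong : ∀ {h h′} → h ≗ h′ → ∀ v → degIn h v ≡ degIn h′ v
  degIn-cong h≗h′ v = sum-cong-≗ (λ u → cong (𝟙 (adj G v u) *_) (h≗h′ u))

  degIn-mono-≤ : ∀ {h h′} → (∀ u → h u ≤ h′ u) → ∀ v → degIn h v ≤ degIn h′ v
  degIn-mono-≤ h≤h′ v = sum-mono-≤ (λ u → *-monoʳ-≤ (𝟙 (adj G v u)) (h≤h′ u))

  degIn-distrib-+ : ∀ h h′ v → degIn (λ u → h u + h′ u) v ≡ degIn h v + degIn h′ v
  degIn-distrib-+ h h′ v =
    trans (sum-cong-≗ (λ u → *-distribˡ-+ (𝟙 (adj G v u)) (h u) (h′ u)))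
          (∑-distrib-+ (λ u → 𝟙 (adj G v u) * h u) (λ u → 𝟙 (adj G v u) * h′ u))

  degIn≡0 : ∀ {h v} → (∀ u → Adj G v u → h u ≡ 0) → degIn h v ≡ 0
  degIn≡0 {h} {v} h≡0 = sum-zero term≡0
    where
    term≡0 : ∀ u → 𝟙 (adj G v u) * h u ≡ 0
    term≡0 u with adj G v u in a
    ... | true = trans (+-identityʳ (h u)) (h≡0 u a)
    ... | false = refl

  degIn≡0⇒ : ∀ {h v u} → degIn h v ≡ 0 → Adj G v u → h u ≡ 0
  degIn≡0⇒ {h} {v} {u} d≡0 a = n≤0⇒n≡0 (begin
    h u                          ≡⟨ sym (+-identityʳ (h u)) ⟩
    1 * h u                      ≡⟨ cong (λ b → 𝟙 b * h u) (sym a) ⟩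
    𝟙 (adj G v u) * h u          ≤⟨ term≤sum (λ w → 𝟙 (adj G v w) * h w) u ⟩
    degIn h v                    ≡⟨ d≡0 ⟩
    0                            ∎)
    where open ≤-Reasoning

  ⟪⟫-cong : ∀ {g g′ h h′} → g ≗ g′ → h ≗ h′ → ⟪ g , h ⟫ ≡ ⟪ g′ , h′ ⟫
  ⟪⟫-cong g≗g′ h≗h′ = sum-cong-≗ (λ v → cong₂ _*_ (g≗g′ v) (degIn-cong h≗h′ v))

  ⟪⟫-comm : ∀ g h → ⟪ g , h ⟫ ≡ ⟪ h , g ⟫
  ⟪⟫-comm g h = begin
    sum (λ v → g v * sum (λ u → 𝟙 (adj G v u) * h u))      ≡⟨ sum-cong-≗ (λ v → *-distribˡ-sum (g v) (λ u → 𝟙 (adj G v u) * h u)) ⟩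
    sum (λ v → sum (λ u → g v * (𝟙 (adj G v u) * h u)))    ≡⟨ ∑-comm (λ v u → g v * (𝟙 (adj G v u) * h u)) ⟩
    sum (λ u → sum (λ v → g v * (𝟙 (adj G v u) * h u)))    ≡⟨ sum-cong-≗ (λ u → sum-cong-≗ (λ v → swap u v)) ⟩
    sum (λ u → sum (λ v → h u * (𝟙 (adj G u v) * g v)))    ≡⟨ sum-cong-≗ (λ u → *-distribˡ-sum (h u) (λ v → 𝟙 (adj G u v) * g v)) ⟨
    sum (λ u → h u * sum (λ v → 𝟙 (adj G u v) * g v))      ∎
    where
    open ≡-Reasoning
    swap : ∀ u v → g v * (𝟙 (adj G v u) * h u) ≡ h u * (𝟙 (adj G u v) * g v)
    swap u v = trans (cong (λ b → g v * (𝟙 b * h u)) (Graph.sym G v u)) (reorder (g v) (𝟙 (adj G u v)) (h u))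
      where
      reorder : ∀ x a y → x * (a * y) ≡ y * (a * x)
      reorder = solve-∀

  ⟪⟫-distribˡ-+ : ∀ g g′ h → ⟪ (λ v → g v + g′ v) , h ⟫ ≡ ⟪ g , h ⟫ + ⟪ g′ , h ⟫
  ⟪⟫-distribˡ-+ g g′ h =
    trans (sum-cong-≗ (λ v → *-distribʳ-+ (degIn h v) (g v) (g′ v)))
          (∑-distrib-+ (λ v → g v * degIn h v) (λ v → g′ v * degIn h v))

  ⟪⟫-distribʳ-+ : ∀ g h h′ → ⟪ g , (λ u → h u + h′ u) ⟫ ≡ ⟪ g , h ⟫ + ⟪ g , h′ ⟫
  ⟪⟫-distribʳ-+ g h h′ = begin
    ⟪ g , (λ u → h u + h′ u) ⟫  ≡⟨ ⟪⟫-comm g _ ⟩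
    ⟪ (λ u → h u + h′ u) , g ⟫  ≡⟨ ⟪⟫-distribˡ-+ h h′ g ⟩
    ⟪ h , g ⟫ + ⟪ h′ , g ⟫      ≡⟨ cong₂ _+_ (⟪⟫-comm h g) (⟪⟫-comm h′ g) ⟩
    ⟪ g , h ⟫ + ⟪ g , h′ ⟫      ∎
    where open ≡-Reasoning

  ⟪δ,⟫ : ∀ x h → ⟪ δ x , h ⟫ ≡ degIn h x
  ⟪δ,⟫ x h = trans (sum-cong-≗ (λ v → *-comm (δ x v) (degIn h v))) (sum-*-δ (degIn h) x)

module Forests {n} (G : Graph n) where
  open Adjacency G
  open import Data.List.Membership.DecPropositional (_≟_ {n}) using (_∈?_)

  Acyclic : (Fin n → Bool) → Set
  Acyclic X = ∀ cs → IsCycle G cs → All (T ∘ X) cs → ⊥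

  anotherNeighbour : ∀ X v y → 2 ≤ degIn (𝟙 ∘ X) v → ∃ λ u → T (X u) × Adj G v u × u ≢ y
  anotherNeighbour X v y 2≤d
    with any? (λ u → T? (X u) ×-dec (adj G v u ≟ᵇ true) ×-dec ¬? (u ≟ y))
  ... | yes (u , Xu , a , u≢y) = u , Xu , a , u≢y
  ... | no none = contradiction 2≤d (<⇒≱ (s≤s (begin
      degIn (𝟙 ∘ X) v  ≤⟨ sum-mono-≤ term≤δ ⟩
      sum (δ y)        ≡⟨ sum-δ y ⟩
      1                ∎)))
    where
    open ≤-Reasoning
    term≤δ : ∀ u → 𝟙 (adj G v u) * 𝟙 (X u) ≤ δ y u
    term≤δ u with adj G v u in a | X u in Xu | y ≟ u
    ... | true  | true  | yes _   = ≤-refl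
    ... | true  | true  | no y≢u  = contradiction (u , Equivalence.from T-≡ Xu , a , y≢u ∘ sym) none
    ... | true  | false | _       = z≤n
    ... | false | _     | _       = z≤n

  module _ (X : Fin n → Bool) (minDeg : ∀ v → T (X v) → 2 ≤ degIn (𝟙 ∘ X) v) where

    Cycle : Set
    Cycle = ∃ λ cs → IsCycle G cs × All (T ∘ X) cs

    previous : Fin n → List (Fin n) → Fin n
    previous v [] = v
    previous v (z ∷ _) = z

    -- The walk is stored reversed, its current end v first; fuel bounds how far it can still grow.
    extendWalk : ∀ fuel v q → n < length (v ∷ q) + fuel →
                 Unique (v ∷ q) → Linked (Adj G) (v ∷ q) → All (T ∘ X) (v ∷ q) → Cycle
    extendWalk fuel v q bound uniq linked inX@(Xv ∷ _)
      with anotherNeighbour X v (previous v q) (minDeg v Xv)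
    ... | u , Xu , a , u≢prev with u ∈? (v ∷ q)
    ...   | yes (here refl) = contradiction refl (Adj⇒≢ a)
    ...   | yes (there (here refl)) = contradiction refl u≢prev
    ...   | yes (there (there p)) =
      takeThrough walk∋u ,
      (s≤s (takeThrough-nonEmpty p) , AllPairs-takeThrough walk∋u uniq , Linked-takeThrough walk∋u linked (Adj-sym a)) ,
      All-takeThrough walk∋u inX
      where walk∋u = there (there p)
    ...   | no u∉walk with fuel
    ...     | zero = contradiction (Unique⇒length≤ (¬Any⇒All¬ (v ∷ q) u∉walk ∷ uniq))
                                   (<⇒≱ (m<n⇒m<1+n (subst (n <_) (+-identityʳ _) bound)))
    ...     | suc k = extendWalk k u (v ∷ q) (subst (n <_) (+-suc _ k) bound)
                        (¬Any⇒All¬ (v ∷ q) u∉walk ∷ uniq) (Adj-sym a ∷ linked) (Xu ∷ inX)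

    minDeg2⇒cycle : ∀ {x} → T (X x) → Cycle
    minDeg2⇒cycle {x} Xx = extendWalk n x [] ≤-refl ([] ∷ []) [-] (Xx ∷ [])

  Acyclic⇒leaf : ∀ {X x} → Acyclic X → T (X x) → ∃ λ y → T (X y) × degIn (𝟙 ∘ X) y ≤ 1
  Acyclic⇒leaf {X} acyclic Xx with any? (λ y → T? (X y) ×-dec (degIn (𝟙 ∘ X) y ≤? 1))
  ... | yes leaf = leaf
  ... | no noLeaf =
    let cs , isCycle , inX = minDeg2⇒cycle X (λ v Xv → ≰⇒> (λ d≤1 → noLeaf (v , Xv , d≤1))) Xx
    in ⊥-elim (acyclic cs isCycle inX)

  without : Fin n → (Fin n → Bool) → Fin n → Bool
  without x X v = X v ∧ not (does (x ≟ v))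

  Acyclic-without : ∀ {X} x → Acyclic X → Acyclic (without x X)
  Acyclic-without {X} x acyclic cs isCycle inX′ =
    acyclic cs isCycle (All.map (λ {v} t → proj₁ (Equivalence.to (T-∧ {X v}) t)) inX′)

  𝟙-without : ∀ {X x} → T (X x) → ∀ v → 𝟙 (X v) ≡ 𝟙 (without x X v) + δ x v
  𝟙-without {X} {x} Xx v with x ≟ v
  ... | no _ = sym (trans (+-identityʳ _) (cong 𝟙 (∧-identityʳ (X v))))
  ... | yes refl with X x | Xx
  ...   | true | _ = refl

  card : (Fin n → Bool) → ℕ
  card X = sum (𝟙 ∘ X)

  card≤n : ∀ X → card X ≤ n
  card≤n X = ≤-trans (sum-mono-≤ (𝟙≤1 ∘ X)) (≤-reflexive (trans (sum-const n 1) (*-identityʳ n)))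

  card-without : ∀ {X x} → T (X x) → card X ≡ card (without x X) + 1
  card-without {X} {x} Xx = begin
    card X                                    ≡⟨ sum-cong-≗ (𝟙-without {X} {x} Xx) ⟩
    sum (λ v → 𝟙 (without x X v) + δ x v)     ≡⟨ ∑-distrib-+ (𝟙 ∘ without x X) (δ x) ⟩
    card (without x X) + sum (δ x)            ≡⟨ cong (card (without x X) +_) (sum-δ x) ⟩
    card (without x X) + 1                    ∎
    where open ≡-Reasoning

  ⟪⟫-without : ∀ {X x} → T (X x) →
               ⟪ 𝟙 ∘ X , 𝟙 ∘ X ⟫ ≤ ⟪ 𝟙 ∘ without x X , 𝟙 ∘ without x X ⟫ + 2 * degIn (𝟙 ∘ X) x
  ⟪⟫-without {X} {x} Xx = begin
    ⟪ 𝟙 ∘ X , 𝟙 ∘ X ⟫                     ≡⟨ ⟪⟫-cong (𝟙-without {X} {x} Xx) (λ _ → refl) ⟩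
    ⟪ (λ v → r v + δ x v) , 𝟙 ∘ X ⟫       ≡⟨ ⟪⟫-distribˡ-+ r (δ x) (𝟙 ∘ X) ⟩
    ⟪ r , 𝟙 ∘ X ⟫ + ⟪ δ x , 𝟙 ∘ X ⟫       ≡⟨ cong₂ _+_ (⟪⟫-cong {g = r} (λ _ → refl) (𝟙-without {X} {x} Xx)) (⟪δ,⟫ x (𝟙 ∘ X)) ⟩
    ⟪ r , (λ v → r v + δ x v) ⟫ + d       ≡⟨ cong (_+ d) (⟪⟫-distribʳ-+ r r (δ x)) ⟩
    ⟪ r , r ⟫ + ⟪ r , δ x ⟫ + d           ≡⟨ cong (λ t → ⟪ r , r ⟫ + t + d) (trans (⟪⟫-comm r (δ x)) (⟪δ,⟫ x r)) ⟩
    ⟪ r , r ⟫ + degIn r x + d             ≤⟨ +-monoˡ-≤ d (+-monoʳ-≤ ⟪ r , r ⟫ r≤X) ⟩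
    ⟪ r , r ⟫ + d + d                     ≡⟨ +-assoc ⟪ r , r ⟫ d d ⟩
    ⟪ r , r ⟫ + (d + d)                   ≡⟨ cong (⟪ r , r ⟫ +_) (cong (d +_) (sym (+-identityʳ d))) ⟩
    ⟪ r , r ⟫ + 2 * d                     ∎
    where
    open ≤-Reasoning
    r = 𝟙 ∘ without x X
    d = degIn (𝟙 ∘ X) x
    r≤X : degIn r x ≤ d
    r≤X = degIn-mono-≤ (λ v → ≤-trans (m≤m+n (r v) (δ x v)) (≤-reflexive (sym (𝟙-without {X} {x} Xx v)))) x

  ⟪⟫-empty : ∀ {X} h → (∀ v → ¬ T (X v)) → ⟪ 𝟙 ∘ X , h ⟫ ≡ 0
  ⟪⟫-empty {X} h empty = sum-zero term≡0
    where
    term≡0 : ∀ v → 𝟙 (X v) * degIn h v ≡ 0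
    term≡0 v with X v | empty v
    ... | true | notTrue = contradiction _ notTrue
    ... | false | _ = refl

  -- ⟪ 𝟙 ∘ X , 𝟙 ∘ X ⟫ counts each edge inside X twice; peel off leaves one at a time.
  Acyclic⇒⟪⟫≤2card : ∀ {X} → Acyclic X → ⟪ 𝟙 ∘ X , 𝟙 ∘ X ⟫ ≤ 2 * card X
  Acyclic⇒⟪⟫≤2card {X} acyclic = go n X (card≤n X) acyclic
    where
    go : ∀ fuel X → card X ≤ fuel → Acyclic X → ⟪ 𝟙 ∘ X , 𝟙 ∘ X ⟫ ≤ 2 * card X
    go fuel X card≤fuel acyclic with any? (λ x → T? (X x))
    ... | no empty = ≤-trans (≤-reflexive (⟪⟫-empty (𝟙 ∘ X) (λ v Xv → empty (v , Xv)))) z≤n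
    ... | yes (x , Xx) with Acyclic⇒leaf acyclic Xx | fuel
    ...   | y , Xy , _ | zero =
      contradiction card≤fuel (<⇒≱ (≤-trans (m≤n+m 1 (card (without y X))) (≤-reflexive (sym (card-without Xy)))))
    ...   | y , Xy , leaf | suc k = begin
      ⟪ 𝟙 ∘ X , 𝟙 ∘ X ⟫                         ≤⟨ ⟪⟫-without Xy ⟩
      ⟪ 𝟙 ∘ X′ , 𝟙 ∘ X′ ⟫ + 2 * degIn (𝟙 ∘ X) y  ≤⟨ +-mono-≤ (go k X′ card′≤k (Acyclic-without y acyclic)) (*-monoʳ-≤ 2 leaf) ⟩
      2 * card X′ + 2 * 1                       ≡⟨ *-distribˡ-+ 2 (card X′) 1 ⟨
      2 * (card X′ + 1)                         ≡⟨ cong (2 *_) (card-without Xy) ⟨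
      2 * card X                                ∎
      where
      open ≤-Reasoning
      X′ = without y X
      card′≤k : card X′ ≤ k
      card′≤k = ≤-pred (≤-trans (≤-reflexive (trans (+-comm 1 (card X′)) (sym (card-without Xy)))) card≤fuel)

module Discharging {n} (G : Graph n) (reduced : Reduced G) (S : Subset n) (fvs : FVS G S) where
  open Adjacency G
  open Forests G

  outside : Fin n → Bool
  outside v = not (lookup S v)

  s f : Fin n → ℕ
  s = 𝟙 ∘ lookup S
  f = 𝟙 ∘ outside

  sealed : Fin n → Bool
  sealed v = (degIn s v ≡ᵇ 0) ∧ (deg G v ≡ᵇ 2)

  Z W : Fin n → Bool
  Z v = outside v ∧ sealed v
  W v = outside v ∧ not (sealed v)

  z w : Fin n → ℕ
  z = 𝟙 ∘ Z
  w = 𝟙 ∘ W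

  1≡s+f : ∀ v → 1 ≡ s v + f v
  1≡s+f v = 𝟙-+-not (lookup S v)

  f≡z+w : ∀ v → f v ≡ z v + w v
  f≡z+w v = 𝟙-split-∧ (outside v) (sealed v)

  deg≡dS+dF : ∀ v → deg G v ≡ degIn s v + degIn f v
  deg≡dS+dF v = trans (deg≡degIn-1 v) (trans (degIn-cong 1≡s+f v) (degIn-distrib-+ s f v))

  dF≡dZ+dW : ∀ v → degIn f v ≡ degIn z v + degIn w v
  dF≡dZ+dW v = trans (degIn-cong f≡z+w v) (degIn-distrib-+ z w v)

  s≡0⇒∉S : ∀ {v} → s v ≡ 0 → v ∉ S
  s≡0⇒∉S {v} s≡0 v∈S with lookup S v | []=⇒lookup v∈S
  s≡0⇒∉S () v∈S | true | refl

  outside⇒∉S : ∀ v → T (outside v) → v ∉ S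
  outside⇒∉S v out v∈S with lookup S v | []=⇒lookup v∈S
  ... | true | refl = out

  acyclic-outside : Acyclic outside
  acyclic-outside cs isCycle inF = fvs cs isCycle (All.map (λ {v} → outside⇒∉S v) inF)

  Z⇒sealed : ∀ {v} → T (Z v) → T (outside v) × degIn s v ≡ 0 × deg G v ≡ 2
  Z⇒sealed {v} Zv with Equivalence.to (T-∧ {outside v}) Zv
  ... | out , sl with Equivalence.to (T-∧ {degIn s v ≡ᵇ 0}) sl
  ...   | dS≡0 , deg≡2 = out , ≡ᵇ⇒≡ _ 0 dS≡0 , ≡ᵇ⇒≡ _ 2 deg≡2

  Z-independent : ∀ {v} → T (Z v) → degIn z v ≡ 0
  Z-independent {v} Zv = degIn≡0 z≡0
    where
    z≡0 : ∀ u → Adj G v u → z u ≡ 0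
    z≡0 u vu with Z u in Zu
    ... | false = refl
    ... | true = contradiction (deg-v≡2 , deg-u≡2 , noCommonNeighbour) (proj₂ reduced v u vu)
      where
      v-sealed = Z⇒sealed {v} Zv
      u-sealed = Z⇒sealed {u} (Equivalence.from T-≡ Zu)
      deg-v≡2 = proj₂ (proj₂ v-sealed)
      deg-u≡2 = proj₂ (proj₂ u-sealed)
      noCommonNeighbour : Empty (N G v ∩ N G u)
      noCommonNeighbour (x , x∈N∩N) = fvs (v ∷ u ∷ x ∷ []) (triangle vu ux (Adj-sym vx))
        (outside⇒∉S v (proj₁ v-sealed) ∷ outside⇒∉S u (proj₁ u-sealed) ∷ s≡0⇒∉S (degIn≡0⇒ (proj₁ (proj₂ v-sealed)) vx) ∷ [])
        where
        vx = ∈N⇒Adj (proj₁ (x∈p∩q⁻ (N G v) (N G u) x∈N∩N))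
        ux = ∈N⇒Adj (proj₂ (x∈p∩q⁻ (N G v) (N G u) x∈N∩N))

  W-weightedDegree : ∀ {v} → T (W v) → 3 ≤ 2 * degIn s v + degIn f v
  W-weightedDegree {v} Wv = 3≤2a+b (degIn s v) (degIn f v) 2≤a+b notSealed
    where
    2≤a+b : 2 ≤ degIn s v + degIn f v
    2≤a+b = ≤-trans (proj₁ reduced v) (≤-reflexive (deg≡dS+dF v))
    notSealed : degIn s v ≡ 0 → degIn s v + degIn f v ≢ 2
    notSealed dS≡0 a+b≡2 = T-not⇒¬T (proj₂ (Equivalence.to (T-∧ {outside v}) Wv))
      (Equivalence.from T-∧ (≡⇒≡ᵇ _ 0 dS≡0 , ≡⇒≡ᵇ _ 2 (trans (deg≡dS+dF v) a+b≡2)))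
    3≤2a+b : ∀ a b → 2 ≤ a + b → (a ≡ 0 → a + b ≢ 2) → 3 ≤ 2 * a + b
    3≤2a+b zero b 2≤b b≢2 = ≤∧≢⇒< 2≤b (≢-sym (b≢2 refl))
    3≤2a+b a@(suc _) b 2≤a+b _ = begin
      3                ≤⟨ +-mono-≤ (s≤s z≤n) 2≤a+b ⟩
      a + (a + b)      ≡⟨ a+[a+b] a b ⟩
      2 * a + b        ∎
      where
      open ≤-Reasoning
      a+[a+b] : ∀ a b → a + (a + b) ≡ 2 * a + b
      a+[a+b] = solve-∀

  Z-charge : ∀ {v} → T (Z v) → 12 ≤ 8 * degIn s v + 5 * degIn f v + degIn w v
  Z-charge {v} Zv =
    ≤-reflexive (sym (cong₂ _+_ (cong₂ (λ a b → 8 * a + 5 * b) dS≡0 dF≡2) dW≡2))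
    where
    dS≡0 = proj₁ (proj₂ (Z⇒sealed {v} Zv))
    dF≡2 : degIn f v ≡ 2
    dF≡2 = trans (cong (_+ degIn f v) (sym dS≡0)) (trans (sym (deg≡dS+dF v)) (proj₂ (proj₂ (Z⇒sealed {v} Zv))))
    dW≡2 : degIn w v ≡ 2
    dW≡2 = trans (cong (_+ degIn w v) (sym (Z-independent Zv))) (trans (sym (dF≡dZ+dW v)) dF≡2)

  W-charge : ∀ {v} → T (W v) → 12 + degIn z v ≤ 8 * degIn s v + 5 * degIn f v
  W-charge {v} Wv = begin
    12 + dZ                    ≤⟨ +-mono-≤ (*-monoʳ-≤ 4 (W-weightedDegree Wv)) dZ≤dF ⟩
    4 * (2 * dS + dF) + dF     ≡⟨ regroup dS dF ⟩
    8 * dS + 5 * dF            ∎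
    where
    open ≤-Reasoning
    dS = degIn s v
    dF = degIn f v
    dZ = degIn z v
    dZ≤dF : dZ ≤ dF
    dZ≤dF = ≤-trans (m≤m+n dZ (degIn w v)) (≤-reflexive (sym (dF≡dZ+dW v)))
    regroup : ∀ a b → 4 * (2 * a + b) + b ≡ 8 * a + 5 * b
    regroup = solve-∀

  charge : ∀ v → 12 * f v + w v * degIn z v ≤ 8 * (f v * degIn s v) + 5 * (f v * degIn f v) + z v * degIn w v
  charge v = begin
    12 * f v + w v * dZ                              ≡⟨ cong (λ t → 12 * t + w v * dZ) (f≡z+w v) ⟩
    12 * (z v + w v) + w v * dZ                      ≡⟨ split (z v) (w v) dZ ⟩
    z v * 12 + w v * (12 + dZ)                       ≤⟨ +-mono-≤ (𝟙*-mono (Z v) Z-charge) (𝟙*-mono (W v) W-charge) ⟩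
    z v * (8 * dS + 5 * dF + dW) + w v * (8 * dS + 5 * dF)
                                                     ≡⟨ merge (z v) (w v) dS dF dW ⟩
    8 * ((z v + w v) * dS) + 5 * ((z v + w v) * dF) + z v * dW
                                                     ≡⟨ cong (λ t → 8 * (t * dS) + 5 * (t * dF) + z v * dW) (f≡z+w v) ⟨
    8 * (f v * dS) + 5 * (f v * dF) + z v * dW       ∎
    where
    open ≤-Reasoning
    dS = degIn s v
    dF = degIn f v
    dZ = degIn z v
    dW = degIn w v
    split : ∀ a b c → 12 * (a + b) + b * c ≡ a * 12 + b * (12 + c)
    split = solve-∀
    merge : ∀ a b x y t → a * (8 * x + 5 * y + t) + b * (8 * x + 5 * y) ≡ 8 * ((a + b) * x) + 5 * ((a + b) * y) + a * t
    merge = solve-∀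

  totalCharge : 12 * card outside + ⟪ w , z ⟫ ≤ 8 * ⟪ f , s ⟫ + 5 * ⟪ f , f ⟫ + ⟪ z , w ⟫
  totalCharge = begin
    12 * sum f + ⟪ w , z ⟫                                  ≡⟨ cong (_+ ⟪ w , z ⟫) (*-distribˡ-sum 12 f) ⟩
    sum (λ v → 12 * f v) + ⟪ w , z ⟫                       ≡⟨ ∑-distrib-+ (λ v → 12 * f v) (λ v → w v * degIn z v) ⟨
    sum (λ v → 12 * f v + w v * degIn z v)                 ≤⟨ sum-mono-≤ charge ⟩
    sum (λ v → 8 * (f v * degIn s v) + 5 * (f v * degIn f v) + z v * degIn w v)
                                                            ≡⟨ ∑-distrib-+ (λ v → 8 * (f v * degIn s v) + 5 * (f v * degIn f v)) (λ v → z v * degIn w v) ⟩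
    sum (λ v → 8 * (f v * degIn s v) + 5 * (f v * degIn f v)) + ⟪ z , w ⟫
                                                            ≡⟨ cong (_+ ⟪ z , w ⟫) (∑-distrib-+ (λ v → 8 * (f v * degIn s v)) (λ v → 5 * (f v * degIn f v))) ⟩
    sum (λ v → 8 * (f v * degIn s v)) + sum (λ v → 5 * (f v * degIn f v)) + ⟪ z , w ⟫
                                                            ≡⟨ cong (_+ ⟪ z , w ⟫) (cong₂ _+_ (*-distribˡ-sum 8 (λ v → f v * degIn s v)) (*-distribˡ-sum 5 (λ v → f v * degIn f v))) ⟨
    8 * ⟪ f , s ⟫ + 5 * ⟪ f , f ⟫ + ⟪ z , w ⟫              ∎
    where open ≤-Reasoning

  outside≤4⟪f,s⟫ : card outside ≤ 4 * ⟪ f , s ⟫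
  outside≤4⟪f,s⟫ = discharge (card outside) ⟪ f , s ⟫ ⟪ f , f ⟫ ⟪ z , w ⟫
    (subst (λ t → 12 * card outside + t ≤ 8 * ⟪ f , s ⟫ + 5 * ⟪ f , f ⟫ + ⟪ z , w ⟫) (⟪⟫-comm w z) totalCharge)
    (Acyclic⇒⟪⟫≤2card acyclic-outside)
    where
    discharge : ∀ c e d x → 12 * c + x ≤ 8 * e + 5 * d + x → d ≤ 2 * c → c ≤ 4 * e
    discharge c e d x total d≤2c = *-cancelˡ-≤ 2 (+-cancelʳ-≤ (10 * c) (2 * c) (2 * (4 * e)) (begin
      2 * c + 10 * c           ≡⟨ lhs c ⟩
      12 * c                   ≤⟨ +-cancelʳ-≤ x (12 * c) (8 * e + 5 * d) total ⟩
      8 * e + 5 * d            ≤⟨ +-monoʳ-≤ (8 * e) (*-monoʳ-≤ 5 d≤2c) ⟩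
      8 * e + 5 * (2 * c)      ≡⟨ rhs e c ⟩
      2 * (4 * e) + 10 * c     ∎))
      where
      open ≤-Reasoning
      lhs : ∀ c → 2 * c + 10 * c ≡ 12 * c
      lhs = solve-∀
      rhs : ∀ e c → 8 * e + 5 * (2 * c) ≡ 2 * (4 * e) + 10 * c
      rhs = solve-∀

  sum-s≡∣S∣ : sum s ≡ ∣ S ∣
  sum-s≡∣S∣ = trans (sym (∣tabulate∣ (lookup S))) (cong ∣_∣ (tabulate∘lookup S))

  ⟪f,s⟫≤Δ∣S∣ : ⟪ f , s ⟫ ≤ maxDeg G * ∣ S ∣
  ⟪f,s⟫≤Δ∣S∣ = begin
    ⟪ f , s ⟫                    ≡⟨ ⟪⟫-comm f s ⟩
    sum (λ v → s v * degIn f v)  ≤⟨ sum-mono-≤ (λ v → *-monoʳ-≤ (s v) (dF≤Δ v)) ⟩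
    sum (λ v → s v * maxDeg G)   ≡⟨ *-distribʳ-sum (maxDeg G) s ⟨
    sum s * maxDeg G             ≡⟨ cong (_* maxDeg G) sum-s≡∣S∣ ⟩
    ∣ S ∣ * maxDeg G             ≡⟨ *-comm ∣ S ∣ (maxDeg G) ⟩
    maxDeg G * ∣ S ∣             ∎
    where
    open ≤-Reasoning
    dF≤Δ : ∀ v → degIn f v ≤ maxDeg G
    dF≤Δ v = ≤-trans (degIn-mono-≤ (𝟙≤1 ∘ outside) v) (≤-trans (≤-reflexive (sym (deg≡degIn-1 v))) (deg≤maxDeg v))

  n≡∣S∣+outside : n ≡ ∣ S ∣ + card outside
  n≡∣S∣+outside = begin
    n                        ≡⟨ trans (sym (*-identityʳ n)) (sym (sum-const n 1)) ⟩
    sum {n} (λ _ → 1)        ≡⟨ sum-cong-≗ 1≡s+f ⟩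
    sum (λ v → s v + f v)    ≡⟨ ∑-distrib-+ s f ⟩
    sum s + sum f            ≡⟨ cong (_+ sum f) sum-s≡∣S∣ ⟩
    ∣ S ∣ + card outside     ∎
    where open ≡-Reasoning

lemma7 : ∀ {n} (G : Graph n) → Reduced G → (S : Subset n) → FVS G S →
         n ≤ 5 * maxDeg G * ∣ S ∣
lemma7 {zero} _ _ _ _ = z≤n
lemma7 {suc m} G reduced S fvs = begin
  suc m                                ≡⟨ n≡∣S∣+outside ⟩
  ∣ S ∣ + card outside                 ≤⟨ +-mono-≤ (m≤n*m ∣ S ∣ Δ) (≤-trans outside≤4⟪f,s⟫ (*-monoʳ-≤ 4 ⟪f,s⟫≤Δ∣S∣)) ⟩
  Δ * ∣ S ∣ + 4 * (Δ * ∣ S ∣)          ≡⟨ collect Δ ∣ S ∣ ⟩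
  5 * Δ * ∣ S ∣                        ∎
  where
  open Discharging G reduced S fvs
  open Adjacency G using (deg≤maxDeg)
  open Forests G using (card)
  open ≤-Reasoning
  Δ = maxDeg G
  instance
    Δ-nonZero : NonZero Δ
    Δ-nonZero = >-nonZero (≤-trans (s≤s z≤n) (≤-trans (proj₁ reduced zero) (deg≤maxDeg zero)))
  collect : ∀ d c → d * c + 4 * (d * c) ≡ 5 * d * c
  collect = solve-∀
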